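{- Let $\Pi$ be a compatible partition system on $X$, let $\mathcal{T}_\Pi=(T;\phi)$, and let $u$ be a vertex of $\mathcal{T}_\Pi$ with $\phi^{ -1}(u)\neq\emptyset$. Let $e$ be an edge of $\mathcal{T}_\Pi$ incident with $u$ and let $B$ be the part of the split $\sigma_e$ with $\phi^{ -1}(u)\subseteq B$. Then there exists $\pi\in\Pi$ with $B\in\pi$.
   Context: $X$ is a finite set with $|X|\ge 2$. A partition of $X$ is a set of $t\ge 2$ pairwise disjoint non-empty subsets (parts) whose union is $X$; an $X$-split is a partition with two parts, written $A|(X-A)$. A partition system is a finite multiset of partitions of $X$; $\Sigma_\Pi=\biguplus_{\pi\in\Pi}\biguplus_{A\in\pi}\{A|(X-A)\}$ (multiset union). A split multiset is compatible if for any two of its splits $A_1|B_1,A_2|B_2$ one of $A_1\cap A_2,A_1\cap B_2,B_1\cap A_2,B_1\cap B_2$ is empty; $\Pi$ is compatible if $\Sigma_\Pi$ is. A weak $X$-tree $(T;\phi)$ is a tree $T$ with $\phi:X\to V(T)$ such that every leaf lies in $\phi(X)$. For an edge $e$, $\sigma_e=A|(X-A)$ with $A=\phi^{ -1}(W)$, $W$ the vertex set of a component of $T-e$; $\Sigma(\mathcal{T})=\biguplus_e\{\sigma_e\}$. For compatible $\Pi$, $\mathcal{T}_\Pi$ is the weak $X$-tree, unique up to isomorphism, with $\Sigma(\mathcal{T}_\Pi)=\Sigma_\Pi$. -}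

module Defs where

open import Data.Nat using (ℕ; _≤_)
open import Data.Fin using (Fin)
open import Data.Fin.Subset using (Subset; _∈_; _∉_; ∁; _∩_; Empty; Nonempty)
open import Data.List using (List; length; lookup)
open import Data.Product using (Σ; _×_; _,_; proj₁; proj₂; ∃)
open import Data.Sum using (_⊎_)
open import Data.Unit using (⊤)
open import Relation.Nullary using (¬_)
open import Relation.Binary.PropositionalEquality using (_≡_; _≢_)
open import Function.Bundles using (_⤖_; Bijection)

-- X is Fin n.  Subsets of X are Data.Fin.Subset.Subset n.

record Partition (n : ℕ) : Set where
  field
    parts    : List (Subset n)
    atLeast2 : 2 ≤ length parts
    nonempty : ∀ i → Nonempty (lookup parts i)
    disjoint : ∀ i j → i ≢ j → Empty (lookup parts i ∩ lookup parts j)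
    covers   : ∀ (x : Fin n) → ∃ λ i → x ∈ lookup parts i
open Partition public

-- A partition system: a finite multiset (list) of partitions.
PartitionSystem : ℕ → Set
PartitionSystem n = List (Partition n)

-- Index set of the multiset Σ_Π: one element per (partition, part).
SIdx : ∀ {n} → PartitionSystem n → Set
SIdx Π = Σ (Fin (length Π)) λ i → Fin (length (parts (lookup Π i)))

-- The part A indexed by an element of SIdx; its split is A|(X-A).
partAt : ∀ {n} (Π : PartitionSystem n) → SIdx Π → Subset n
partAt Π (i , j) = lookup (parts (lookup Π i)) j

CompatibleSplits : ∀ {n} → Subset n → Subset n → Set
CompatibleSplits A₁ A₂ =
  Empty (A₁ ∩ A₂) ⊎ Empty (A₁ ∩ ∁ A₂) ⊎ Empty (∁ A₁ ∩ A₂) ⊎ Empty (∁ A₁ ∩ ∁ A₂)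

Compatible : ∀ {n} → PartitionSystem n → Set
Compatible Π = ∀ (a b : SIdx Π) → CompatibleSplits (partAt Π a) (partAt Π b)

record Graph : Set where
  field
    m    : ℕ
    k    : ℕ
    ends : Fin k → Fin m × Fin m
open Graph public

Incident : (G : Graph) → Fin (k G) → Fin (m G) → Set
Incident G e v = proj₁ (ends G e) ≡ v ⊎ proj₂ (ends G e) ≡ v

data Walk (G : Graph) (ok : Fin (k G) → Set) : Fin (m G) → Fin (m G) → Set where
  here : ∀ {a} → Walk G ok a a
  step : ∀ {a b c} (f : Fin (k G)) → ok f →
         ((proj₁ (ends G f) ≡ a × proj₂ (ends G f) ≡ b) ⊎
          (proj₂ (ends G f) ≡ a × proj₁ (ends G f) ≡ b)) →
         Walk G ok b c → Walk G ok a c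

ReachWithout : (G : Graph) → Fin (k G) → Fin (m G) → Fin (m G) → Set
ReachWithout G e = Walk G (λ f → f ≢ e)

-- A tree: connected, and acyclic (expressed as: every edge is a bridge,
-- i.e. its endpoints are disconnected in T - e; this rules out loops,
-- parallel edges and cycles).
record IsTree (G : Graph) : Set where
  field
    connected : ∀ a b → Walk G (λ _ → ⊤) a b
    acyclic   : ∀ e → ¬ ReachWithout G e (proj₁ (ends G e)) (proj₂ (ends G e))

Leaf : (G : Graph) → Fin (m G) → Set
Leaf G v = Σ (Fin (k G)) λ e → Incident G e v × (∀ f → Incident G f v → f ≡ e)

record WeakXTree (n : ℕ) : Set where
  field
    T      : Graph
    isTree : IsTree T
    φ      : Fin n → Fin (m T)
    leavesLabelled : ∀ v → Leaf T v → ∃ λ x → φ x ≡ v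
open WeakXTree public

-- x ∈ φ⁻¹(W), W the component of T - e containing vertex v.
SideOf : ∀ {n} (𝒯 : WeakXTree n) → Fin (k (T 𝒯)) → Fin (m (T 𝒯)) → Fin n → Set
SideOf 𝒯 e v x = ReachWithout (T 𝒯) e v (φ 𝒯 x)

SameSplit : ∀ {n} → (Fin n → Set) → Subset n → Set
SameSplit {n} A C = (∀ x → (A x → x ∈ C) × (x ∈ C → A x))
                  ⊎ (∀ x → (A x → x ∉ C) × (x ∉ C → A x))

-- Σ(𝒯) = Σ_Π as multisets: a bijection between the edges of T and the
-- indices of Σ_Π matching σ_e (taken with the side of the first endpoint)
-- with the corresponding split.
DisplaysSplits : ∀ {n} → WeakXTree n → PartitionSystem n → Set
DisplaysSplits 𝒯 Π =
  Σ (Fin (k (T 𝒯)) ⤖ SIdx Π) λ β →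
    ∀ e → SameSplit (SideOf 𝒯 e (proj₁ (ends (T 𝒯) e))) (partAt Π (Bijection.to β e))

module Submission where

-- Let e join u to w and let A|(X-A) be the split of Π that
-- the tree displays on e, A being a part of some π ∈ Π.  In a tree each
-- edge cuts the vertices into exactly two sides, so the labels on u's
-- side of e form either A or X-A.  In the first case B = A.  Otherwise
-- the label x₀ at u lies in another part C of the same partition π, and
-- C is displayed by an edge f ≠ e whose u-side carries exactly C.  Then C
-- is also the u-side B of e: C ⊆ X-A = B by disjointness of parts, and a
-- label on u's side of e that f separates from u would force the whole
-- w-side of e, hence the non-empty part A, onto u's side of f, i.e. into
-- C — impossible.

open import Defs
open import Data.Nat using (ℕ; _≤_)
open import Data.Fin using (Fin; _≟_)
open import Data.Fin.Subset using (Subset; _∈_; _∉_; ∁)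
open import Data.Fin.Subset.Properties using (x∈∁p⇒x∉p; x∉p⇒x∈∁p; x∉∁p⇒x∈p; x∈p∩q⁺)
open import Data.List using (length; lookup)
open import Data.Product using (Σ; _×_; _,_; proj₁; proj₂; ∃)
open import Data.Sum using (_⊎_; inj₁; inj₂; swap)
open import Data.Empty using (⊥-elim)
open import Relation.Nullary using (¬_; yes; no)
open import Relation.Binary.PropositionalEquality using (_≡_; _≢_; refl; sym; subst)
open import Function.Bundles using (_⇔_; mk⇔; Equivalence; Bijection)

module WalkProperties (G : Graph) where

  private
    V : Set
    V = Fin (m G)
    E : Set
    E = Fin (k G)

  end₁ end₂ : E → V
  end₁ f = proj₁ (ends G f)
  end₂ f = proj₂ (ends G f)

  Joins : E → V → V → Set
  Joins f a b = (end₁ f ≡ a × end₂ f ≡ b) ⊎ (end₂ f ≡ a × end₁ f ≡ b)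

  joins-sym : ∀ {f a b} → Joins f a b → Joins f b a
  joins-sym (inj₁ (p , q)) = inj₂ (q , p)
  joins-sym (inj₂ (p , q)) = inj₁ (q , p)

  joins-ends : ∀ f → Joins f (end₁ f) (end₂ f)
  joins-ends f = inj₁ (refl , refl)

  otherEnd : ∀ {f u} → Incident G f u → ∃ λ w → Joins f u w
  otherEnd (inj₁ eq) = _ , inj₁ (eq , refl)
  otherEnd (inj₂ eq) = _ , inj₂ (eq , refl)

  _++ʷ_ : ∀ {ok a b c} → Walk G ok a b → Walk G ok b c → Walk G ok a c
  here           ++ʷ q = q
  step f o j p ++ʷ q = step f o j (p ++ʷ q)

  reverseʷ : ∀ {ok a b} → Walk G ok a b → Walk G ok b a
  reverseʷ here           = here
  reverseʷ (step f o j p) = reverseʷ p ++ʷ step f o (joins-sym j) here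

  ReachesEndOf : (E → Set) → E → V → Set
  ReachesEndOf ok f a = Walk G ok a (end₁ f) ⊎ Walk G ok a (end₂ f)

  firstUse : ∀ f {ok a c} → Walk G ok a c → ReachWithout G f a c ⊎ ReachesEndOf ok f a
  firstUse f here = inj₁ here
  firstUse f (step g o j p) with g ≟ f
  firstUse f (step g o (inj₁ (eq , _)) p) | yes refl =
    inj₂ (inj₁ (subst (λ z → Walk G _ z (end₁ g)) eq here))
  firstUse f (step g o (inj₂ (eq , _)) p) | yes refl =
    inj₂ (inj₂ (subst (λ z → Walk G _ z (end₂ g)) eq here))
  ... | no g≢f with firstUse f p
  ...   | inj₁ q         = inj₁ (step g g≢f j q)
  ...   | inj₂ (inj₁ q) = inj₂ (inj₁ (step g o j q))
  ...   | inj₂ (inj₂ q) = inj₂ (inj₂ (step g o j q))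

  lastUse : ∀ f {ok a c} → Walk G ok a c →
            ReachWithout G f a c ⊎ ReachWithout G f (end₁ f) c ⊎ ReachWithout G f (end₂ f) c
  lastUse f here = inj₁ here
  lastUse f (step g o j p) with lastUse f p
  ... | inj₂ q = inj₂ q
  ... | inj₁ q with g ≟ f
  ...   | no g≢f = inj₁ (step g g≢f j q)
  lastUse f (step g o (inj₁ (_ , eq)) p) | inj₁ q | yes refl =
    inj₂ (inj₂ (subst (λ z → ReachWithout G g z _) (sym eq) q))
  lastUse f (step g o (inj₂ (_ , eq)) p) | inj₁ q | yes refl =
    inj₂ (inj₁ (subst (λ z → ReachWithout G g z _) (sym eq) q))

  meetAt : ∀ {e f a b} → f ≢ e → ReachesEndOf (_≢ e) f a → ReachesEndOf (_≢ e) f b →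
           ReachWithout G e a b
  meetAt f≢e (inj₁ p) (inj₁ q) = p ++ʷ reverseʷ q
  meetAt f≢e (inj₂ p) (inj₂ q) = p ++ʷ reverseʷ q
  meetAt {f = f} f≢e (inj₁ p) (inj₂ q) = p ++ʷ (step f f≢e (joins-ends f) here ++ʷ reverseʷ q)
  meetAt {f = f} f≢e (inj₂ p) (inj₁ q) = p ++ʷ (step f f≢e (joins-sym (joins-ends f)) here ++ʷ reverseʷ q)

module TreeSides (G : Graph) (tree : IsTree G) where
  open WalkProperties G

  endSides : ∀ f v → ReachWithout G f (end₁ f) v ⊎ ReachWithout G f (end₂ f) v
  endSides f v with lastUse f (IsTree.connected tree (end₁ f) v)
  ... | inj₁ p         = inj₁ p
  ... | inj₂ (inj₁ p) = inj₁ p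
  ... | inj₂ (inj₂ p) = inj₂ p

  sides : ∀ {f a b} → Joins f a b → ∀ v → ReachWithout G f a v ⊎ ReachWithout G f b v
  sides {f} (inj₁ (refl , refl)) v = endSides f v
  sides {f} (inj₂ (refl , refl)) v = swap (endSides f v)

  separated : ∀ {f a b} → Joins f a b → ¬ ReachWithout G f a b
  separated {f} (inj₁ (refl , refl)) = IsTree.acyclic tree f
  separated {f} (inj₂ (refl , refl)) p = IsTree.acyclic tree f (reverseʷ p)

  sideOf : ∀ {f a b} → Joins f a b → ∀ u →
           (∀ v → ReachWithout G f u v ⇔ ReachWithout G f a v) ⊎
           (∀ v → ReachWithout G f u v ⇔ (¬ ReachWithout G f a v))
  sideOf j u with sides j u
  ... | inj₁ a→u = inj₁ λ v → mk⇔ (a→u ++ʷ_) (reverseʷ a→u ++ʷ_)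
  ... | inj₂ b→u = inj₂ λ v → mk⇔ acrossFromA towardsB
    where
    acrossFromA : ∀ {v} → ReachWithout G _ u v → ¬ ReachWithout G _ _ v
    acrossFromA u→v a→v = separated j (a→v ++ʷ reverseʷ (b→u ++ʷ u→v))
    towardsB : ∀ {v} → ¬ ReachWithout G _ _ v → ReachWithout G _ u v
    towardsB {v} a↛v with sides j v
    ... | inj₁ a→v = ⊥-elim (a↛v a→v)
    ... | inj₂ b→v = reverseʷ b→u ++ʷ b→v

  farSide : ∀ {e f u w v} → Joins e u w → f ≢ e → ReachWithout G e u v →
            ReachWithout G f u v ⊎ (∀ {v′} → ReachWithout G e w v′ → ReachWithout G f u v′)
  farSide {e} {f} j f≢e u→v with firstUse f u→v
  ... | inj₁ u→v-avoiding-f = inj₁ u→v-avoiding-f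
  ... | inj₂ u→f = inj₂ wSideInside
    where
    wSideInside : ∀ {v′} → ReachWithout G e _ v′ → ReachWithout G f _ v′
    wSideInside w→v′ with firstUse f w→v′
    ... | inj₁ w→v′-avoiding-f = step e (λ e≡f → f≢e (sym e≡f)) j here ++ʷ w→v′-avoiding-f
    ... | inj₂ w→f = ⊥-elim (separated j (meetAt f≢e u→f w→f))

_≐_ : ∀ {n} → Subset n → (Fin n → Set) → Set
C ≐ P = ∀ x → (x ∈ C → P x) × (P x → x ∈ C)

sameSplit⇒≐ : ∀ {n} {P : Fin n → Set} {C} → SameSplit P C → C ≐ P ⊎ ∁ C ≐ P
sameSplit⇒≐ (inj₁ same) = inj₁ λ x → proj₂ (same x) , proj₁ (same x)
sameSplit⇒≐ (inj₂ opp)  = inj₂ λ x → (λ x∈∁C → proj₂ (opp x) (x∈∁p⇒x∉p x∈∁C)) ,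
                                     (λ Px → x∉p⇒x∈∁p (proj₁ (opp x) Px))

≐-resp-⇔ : ∀ {n} {P Q : Fin n → Set} {C} → C ≐ P → (∀ x → Q x ⇔ P x) → C ≐ Q
≐-resp-⇔ C≐P Q⇔P x = (λ x∈C → from (proj₁ (C≐P x) x∈C)) , (λ Qx → proj₂ (C≐P x) (to Qx))
  where open Equivalence (Q⇔P x)

≐-complement : ∀ {n} {P Q : Fin n → Set} {C} → C ≐ P → (∀ x → Q x ⇔ (¬ P x)) → ∁ C ≐ Q
≐-complement C≐P Q⇔¬P x =
  (λ x∈∁C → from λ Px → x∈∁p⇒x∉p x∈∁C (proj₂ (C≐P x) Px)) ,
  (λ Qx → x∉p⇒x∈∁p λ x∈C → to Qx (proj₁ (C≐P x) x∈C))
  where open Equivalence (Q⇔¬P x)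

≐-uncomplement : ∀ {n} {P Q : Fin n → Set} {C} → ∁ C ≐ P → (∀ x → Q x ⇔ (¬ P x)) → C ≐ Q
≐-uncomplement ∁C≐P Q⇔¬P x =
  (λ x∈C → from λ Px → x∈∁p⇒x∉p (proj₂ (∁C≐P x) Px) x∈C) ,
  (λ Qx → x∉∁p⇒x∈p λ x∈∁C → to Qx (proj₁ (∁C≐P x) x∈∁C))
  where open Equivalence (Q⇔¬P x)

module Orientation {n} (𝒯 : WeakXTree n) where
  open WalkProperties (T 𝒯)
  open TreeSides (T 𝒯) (isTree 𝒯)

  orient : ∀ {f C} → SameSplit (SideOf 𝒯 f (end₁ f)) C → ∀ u →
           C ≐ SideOf 𝒯 f u ⊎ ∁ C ≐ SideOf 𝒯 f u
  orient {f} displayed u with sideOf (joins-ends f) u | sameSplit⇒≐ displayed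
  ... | inj₁ same | inj₁ C≐  = inj₁ (≐-resp-⇔ C≐ (λ x → same (φ 𝒯 x)))
  ... | inj₁ same | inj₂ ∁C≐ = inj₂ (≐-resp-⇔ ∁C≐ (λ x → same (φ 𝒯 x)))
  ... | inj₂ opp  | inj₁ C≐  = inj₂ (≐-complement C≐ (λ x → opp (φ 𝒯 x)))
  ... | inj₂ opp  | inj₂ ∁C≐ = inj₁ (≐-uncomplement ∁C≐ (λ x → opp (φ 𝒯 x)))

  orientByLabel : ∀ {f C x u} → SameSplit (SideOf 𝒯 f (end₁ f)) C →
                  x ∈ C → SideOf 𝒯 f u x → C ≐ SideOf 𝒯 f u
  orientByLabel {x = x} displayed x∈C x-on-side with orient displayed _
  ... | inj₁ C≐  = C≐
  ... | inj₂ ∁C≐ = ⊥-elim (x∈∁p⇒x∉p (proj₂ (∁C≐ x) x-on-side) x∈C)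

apart : ∀ {n} (P : Partition n) {i j x} → i ≢ j →
        x ∈ lookup (parts P) i → x ∉ lookup (parts P) j
apart P i≢j x∈i x∈j = disjoint P _ _ i≢j (_ , x∈p∩q⁺ (x∈i , x∈j))

module Displayed {n} (Π : PartitionSystem n) (𝒯 : WeakXTree n) (display : DisplaysSplits 𝒯 Π) where
  open WalkProperties (T 𝒯)
  open TreeSides (T 𝒯) (isTree 𝒯)
  open Orientation 𝒯

  open Bijection (proj₁ display) using (strictlySurjective)

  displayedPart : Fin (k (T 𝒯)) → SIdx Π
  displayedPart = Bijection.to (proj₁ display)

  displays : ∀ f → SameSplit (SideOf 𝒯 f (end₁ f)) (partAt Π (displayedPart f))
  displays = proj₂ display

  partAtLabel : ∀ {e u w x₀} → Joins e u w → φ 𝒯 x₀ ≡ u →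
                ∁ (partAt Π (displayedPart e)) ≐ SideOf 𝒯 e u →
                Σ (SIdx Π) λ p → partAt Π p ≐ SideOf 𝒯 e u
  partAtLabel {e} {u} {w} {x₀} j φx₀≡u ∁A≐ = (i , c) , C≐
    where
    i : Fin (length Π)
    i = proj₁ (displayedPart e)
    π : Partition n
    π = lookup Π i
    a : Fin (length (parts π))
    a = proj₂ (displayedPart e)
    labelAt : ∀ g → SideOf 𝒯 g u x₀
    labelAt g = subst (ReachWithout (T 𝒯) g u) (sym φx₀≡u) here
    x₀∉A : x₀ ∉ partAt Π (i , a)
    x₀∉A = x∈∁p⇒x∉p (proj₂ (∁A≐ x₀) (labelAt e))
    c : Fin (length (parts π))
    c = proj₁ (covers π x₀)
    x₀∈C : x₀ ∈ partAt Π (i , c)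
    x₀∈C = proj₂ (covers π x₀)
    c≢a : c ≢ a
    c≢a c≡a = x₀∉A (subst (λ z → x₀ ∈ lookup (parts π) z) c≡a x₀∈C)
    f : Fin (k (T 𝒯))
    f = proj₁ (strictlySurjective (i , c))
    to-f : displayedPart f ≡ (i , c)
    to-f = proj₂ (strictlySurjective (i , c))
    f≢e : f ≢ e
    f≢e f≡e = x₀∉A (subst (λ g → x₀ ∈ partAt Π (displayedPart g)) f≡e
                           (subst (λ p → x₀ ∈ partAt Π p) (sym to-f) x₀∈C))
    C≐side-of-f : partAt Π (i , c) ≐ SideOf 𝒯 f u
    C≐side-of-f = orientByLabel f-displays-C x₀∈C (labelAt f)
      where
      f-displays-C : SameSplit (SideOf 𝒯 f (end₁ f)) (partAt Π (i , c))
      f-displays-C = subst (λ p → SameSplit (SideOf 𝒯 f (end₁ f)) (partAt Π p)) to-f (displays f)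
    aₓ : Fin n
    aₓ = proj₁ (nonempty π a)
    aₓ∈A : aₓ ∈ partAt Π (i , a)
    aₓ∈A = proj₂ (nonempty π a)
    aₓ-not-on-side-of-f : ¬ SideOf 𝒯 f u aₓ
    aₓ-not-on-side-of-f on = apart π c≢a (proj₂ (C≐side-of-f aₓ) on) aₓ∈A
    aₓ-on-w-side : ReachWithout (T 𝒯) e w (φ 𝒯 aₓ)
    aₓ-on-w-side with sides j (φ 𝒯 aₓ)
    ... | inj₁ on-u-side = ⊥-elim (x∈∁p⇒x∉p (proj₂ (∁A≐ aₓ) on-u-side) aₓ∈A)
    ... | inj₂ on-w-side = on-w-side
    C≐ : partAt Π (i , c) ≐ SideOf 𝒯 e u
    C≐ x = (λ x∈C → proj₁ (∁A≐ x) (x∉p⇒x∈∁p (apart π c≢a x∈C))) , inC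
      where
      inC : SideOf 𝒯 e u x → x ∈ partAt Π (i , c)
      inC on-side with farSide j f≢e on-side
      ... | inj₁ on-side-of-f = proj₂ (C≐side-of-f x) on-side-of-f
      ... | inj₂ w-side⊆ = ⊥-elim (aₓ-not-on-side-of-f (w-side⊆ aₓ-on-w-side))

lemma3p1 : ∀ (n : ℕ) → 2 ≤ n → (Π : PartitionSystem n) → Compatible Π →
           (𝒯 : WeakXTree n) → DisplaysSplits 𝒯 Π →
           (u : Fin (m (T 𝒯))) → (∃ λ x → φ 𝒯 x ≡ u) →
           (e : Fin (k (T 𝒯))) → Incident (T 𝒯) e u →
           Σ (SIdx Π) λ p → ∀ x → (x ∈ partAt Π p → SideOf 𝒯 e u x) × (SideOf 𝒯 e u x → x ∈ partAt Π p)
lemma3p1 _ _ Π _ 𝒯 display u (_ , φx₀≡u) e incident = uSide (otherEnd incident)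
  where
  open WalkProperties (T 𝒯)
  open Orientation 𝒯
  open Displayed Π 𝒯 display
  uSide : ∃ (Joins e u) → Σ (SIdx Π) λ p → partAt Π p ≐ SideOf 𝒯 e u
  uSide (w , joins) with orient (displays e) u
  ... | inj₁ A≐  = displayedPart e , A≐
  ... | inj₂ ∁A≐ = partAtLabel joins φx₀≡u ∁A≐
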